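{- Let $A,B$ be $(n,d)$-types such that the comparability graph $G_{A,B}$ is acyclic. Then $\mathcal C_A\cap\mathcal C_B=\mathcal C_{A\cap B}$.
   Context: $[d]=\{1,\dots,d\}$. An $(n,d)$-type is an $n$-tuple $A=(A_1,\dots,A_n)$ of non-empty subsets of $[d]$; $A\cap B=(A_1\cap B_1,\dots,A_n\cap B_n)$. For $F\subseteq[d]$ let $\Delta_F=\mathrm{conv}\{e_j:j\in F\}\subset\mathbb R^d$ (empty if $F=\emptyset$), and $\mathcal C_A=\Delta_{A_1}+\dots+\Delta_{A_n}$ (Minkowski sum; empty if some entry is empty). The comparability graph $G_{A,B}$ is the multigraph on node set $[d]$ having, for each $i\in[n]$ and each $j\in A_i$, $k\in B_i$ with $j\neq k$, an edge which is undirected if $j,k\in A_i\cap B_i$ and directed $j\to k$ otherwise. A directed cycle is a closed sequence of incident edges at least one of which is directed and all directed edges of which point in the same direction along the sequence; $G_{A,B}$ is acyclic if it has no directed cycle.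
   Formalization: Points, including the summands of the Minkowski sums, have rational coordinates, lying in ℚ^d rather than ℝ^d, and the coefficients of the convex combinations defining Δ_F are rational. -}

module Defs where

open import Data.Nat using (ℕ; zero; suc)
open import Data.Fin using (Fin; zero; suc; _≟_)
open import Data.Fin.Subset using (Subset; _∈_; _∩_; Nonempty)
open import Data.Rational using (ℚ; 0ℚ; 1ℚ; _+_; _*_; _≤_)
open import Data.Product using (Σ; _×_; _,_; proj₁; ∃)
open import Relation.Binary.PropositionalEquality using (_≡_; _≢_)
open import Relation.Nullary using (¬_; yes; no)

∑ : ∀ {m} → (Fin m → ℚ) → ℚ
∑ {zero}  f = 0ℚ
∑ {suc m} f = f zero + ∑ (λ i → f (suc i))

Point : ℕ → Set
Point d = Fin d → ℚ

_·_ : ∀ {d} → ℚ → Point d → Point d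
(c · x) j = c * x j

∑ᵖ : ∀ {m d} → (Fin m → Point d) → Point d
∑ᵖ f j = ∑ (λ i → f i j)

e : ∀ {d} → Fin d → Point d
e j k with j ≟ k
... | yes _ = 1ℚ
... | no  _ = 0ℚ

-- Δ_F = conv { e_j : j ∈ F }  (membership predicate; empty if F = ∅)
_∈Δ_ : ∀ {d} → Point d → Subset d → Set
_∈Δ_ {d} x F =
  Σ (Fin d → ℚ) λ λ' →
    (∀ j → 0ℚ ≤ λ' j) ×
    (∀ j → ¬ (j ∈ F) → λ' j ≡ 0ℚ) ×
    (∑ λ' ≡ 1ℚ) ×
    (x ≡ ∑ᵖ (λ j → λ' j · e j))

Tuple : ℕ → ℕ → Set
Tuple n d = Fin n → Subset d

NDType : ℕ → ℕ → Set
NDType n d = Σ (Tuple n d) λ A → ∀ i → Nonempty (A i)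

_∩ᵗ_ : ∀ {n d} → Tuple n d → Tuple n d → Tuple n d
(A ∩ᵗ B) i = A i ∩ B i

-- C_A = Δ_{A_1} + ... + Δ_{A_n}  (Minkowski sum)
_∈C_ : ∀ {n d} → Point d → Tuple n d → Set
_∈C_ {n} {d} x A =
  Σ (Fin n → Point d) λ y → (∀ i → y i ∈Δ A i) × (x ≡ ∑ᵖ y)

-- Comparability graph G_{A,B}: one edge for each i, j ∈ A_i, k ∈ B_i, j ≠ k,
-- with endpoints src = j, tgt = k.
record Edge {n d} (A B : Tuple n d) : Set where
  constructor edge
  field
    idx   : Fin n
    src   : Fin d
    tgt   : Fin d
    src∈A : src ∈ A idx
    tgt∈B : tgt ∈ B idx
    src≢tgt : src ≢ tgt
open Edge public

Undirected : ∀ {n d} {A B : Tuple n d} → Edge A B → Set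
Undirected {A = A} {B} ed =
  (src ed ∈ (A (idx ed) ∩ B (idx ed))) × (tgt ed ∈ (A (idx ed) ∩ B (idx ed)))

Directed : ∀ {n d} {A B : Tuple n d} → Edge A B → Set
Directed ed = ¬ Undirected ed

data Walk {n d} (A B : Tuple n d) : Fin d → Fin d → Set where
  []  : ∀ {u} → Walk A B u u
  fwd : ∀ {w} (ed : Edge A B) → Walk A B (tgt ed) w → Walk A B (src ed) w
  bwd : ∀ {w} (ed : Edge A B) → Undirected ed → Walk A B (src ed) w → Walk A B (tgt ed) w

data HasDirected {n d} {A B : Tuple n d} : ∀ {u w} → Walk A B u w → Set where
  here  : ∀ {w} (ed : Edge A B) (p : Walk A B (tgt ed) w) → Directed ed → HasDirected (fwd ed p)
  there-fwd : ∀ {w} (ed : Edge A B) (p : Walk A B (tgt ed) w) → HasDirected p → HasDirected (fwd ed p)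
  there-bwd : ∀ {w} (ed : Edge A B) (u : Undirected ed) (p : Walk A B (src ed) w) → HasDirected p → HasDirected (bwd ed u p)

DirectedCycle : ∀ {n d} → Tuple n d → Tuple n d → Set
DirectedCycle {d = d} A B = Σ (Fin d) λ u → Σ (Walk A B u u) HasDirected

Acyclic : ∀ {n d} → Tuple n d → Tuple n d → Set
Acyclic A B = ¬ DirectedCycle A B

-- Write x = Σ yᵢ = Σ zᵢ with yᵢ ∈ Δ_{Aᵢ} and zᵢ ∈ Δ_{Bᵢ}, and suppose yᵢ₀ puts positive mass
-- on some j ∈ A_{i₀} ∖ B_{i₀}.  Let T be the set of nodes reached from j by a walk through a
-- directed edge.  T is closed in the sense that Aᵢ ∩ T ≠ ∅ forces Bᵢ ⊆ T, it contains B_{i₀}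
-- (one directed edge from j), and it misses j by acyclicity.  Hence the mass on T satisfies
-- yᵢ(T) ≤ zᵢ(T) for every i, strictly for i₀, whereas Σ yᵢ(T) = x(T) = Σ zᵢ(T).
-- Membership in T need not be decidable, but as the goal is a contradiction, excluded
-- middle for each of the finitely many nodes may be assumed.
module Submission where

open import Defs
open import Data.Nat using (ℕ)
open import Data.Product using (_×_; proj₁)
open import Function.Bundles using (_⇔_)

open import Algebra.Bundles using (CommutativeRing)
open import Data.Fin using (Fin; zero; suc; punchIn; _≟_)
open import Data.Fin.Properties using (any?; punchInᵢ≢i; sequence)
open import Data.Fin.Subset using (Subset; _∈_; _∉_; _∩_; _⊆_)
open import Data.Fin.Subset.Properties using (_∈?_; x∈p∩q⁺; p∩q⊆p; p∩q⊆q)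
open import Data.Product using (Σ; _,_; proj₂)
open import Data.Rational using (ℚ; 0ℚ; 1ℚ; _+_; _*_; _≤_; _<_)
import Data.Rational.Properties as ℚ
open import Effect.Monad using (RawMonad)
open import Function.Base using (_∘_)
open import Function.Bundles using (mk⇔)
open import Level using (Level)
open import Relation.Binary.PropositionalEquality
open import Relation.Nullary using (¬_; Dec; yes; no; contradiction)
open import Relation.Nullary.Decidable using (_×-dec_; ¬¬-excluded-middle)
open import Relation.Nullary.Negation using (¬¬-Monad)
open import Relation.Unary using (Pred; Decidable)

open import Algebra.Properties.Semiring.Sum (CommutativeRing.semiring ℚ.+-*-commutativeRing)
  using (sum; sum-remove; sum-cong-≗; sum-replicate-zero) renaming (∑-comm to sum-comm)

private
  variable
    ℓ : Level
    m n d : ℕ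

∑≡sum : (f : Fin m → ℚ) → ∑ f ≡ sum f
∑≡sum {ℕ.zero}  f = refl
∑≡sum {ℕ.suc m} f = cong (f zero +_) (∑≡sum (f ∘ suc))

∑-cong : {f g : Fin m → ℚ} → (∀ i → f i ≡ g i) → ∑ f ≡ ∑ g
∑-cong {f = f} {g} f≗g = trans (∑≡sum f) (trans (sum-cong-≗ f≗g) (sym (∑≡sum g)))

∑-zero : ∑ {m} (λ _ → 0ℚ) ≡ 0ℚ
∑-zero {m} = trans (∑≡sum {m} (λ _ → 0ℚ)) (sum-replicate-zero m)

∑-comm : (f : Fin m → Fin n → ℚ) → ∑ (λ i → ∑ (f i)) ≡ ∑ (λ k → ∑ (λ i → f i k))
∑-comm {m} {n} f = begin
  ∑ (λ i → ∑ (f i))             ≡⟨ ∑-cong {m} (λ i → ∑≡sum (f i)) ⟩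
  ∑ (λ i → sum (f i))           ≡⟨ ∑≡sum {m} _ ⟩
  sum (λ i → sum (f i))         ≡⟨ sum-comm f ⟩
  sum (λ k → sum (λ i → f i k)) ≡⟨ sym (∑≡sum {n} _) ⟩
  ∑ (λ k → sum (λ i → f i k))   ≡⟨ ∑-cong {n} (λ k → sym (∑≡sum {m} _)) ⟩
  ∑ (λ k → ∑ (λ i → f i k))     ∎
  where open ≡-Reasoning

∑-supported : (f : Fin m → ℚ) (i : Fin m) → (∀ j → j ≢ i → f j ≡ 0ℚ) → ∑ f ≡ f i
∑-supported {ℕ.suc m} f i vanishes = begin
  ∑ f                                    ≡⟨ ∑≡sum f ⟩
  sum f                                  ≡⟨ sum-remove f ⟩
  f i + sum (f ∘ punchIn i)              ≡⟨ cong (f i +_) (sum-cong-≗ (λ j → vanishes _ (punchInᵢ≢i i j))) ⟩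
  f i + sum {m} (λ _ → 0ℚ)               ≡⟨ cong (f i +_) (sum-replicate-zero m) ⟩
  f i + 0ℚ                               ≡⟨ ℚ.+-identityʳ (f i) ⟩
  f i                                    ∎
  where open ≡-Reasoning

∑-mono-≤ : {f g : Fin m → ℚ} → (∀ i → f i ≤ g i) → ∑ f ≤ ∑ g
∑-mono-≤ {ℕ.zero}  f≤g = ℚ.≤-refl
∑-mono-≤ {ℕ.suc m} f≤g = ℚ.+-mono-≤ (f≤g zero) (∑-mono-≤ (f≤g ∘ suc))

∑-mono-< : {f g : Fin m → ℚ} → (∀ i → f i ≤ g i) → ∀ i → f i < g i → ∑ f < ∑ g
∑-mono-< f≤g zero    fi<gi = ℚ.+-mono-<-≤ fi<gi (∑-mono-≤ (f≤g ∘ suc))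
∑-mono-< f≤g (suc i) fi<gi = ℚ.+-mono-≤-< (f≤g zero) (∑-mono-< (f≤g ∘ suc) i fi<gi)

e-diagonal : (k : Fin d) → e k k ≡ 1ℚ
e-diagonal k with k ≟ k
... | yes _   = refl
... | no k≢k = contradiction refl k≢k

e-offDiagonal : {j k : Fin d} → j ≢ k → e j k ≡ 0ℚ
e-offDiagonal {j = j} {k} j≢k with j ≟ k
... | yes j≡k = contradiction j≡k j≢k
... | no _    = refl

∈Δ-coordinate : {x : Point d} {F : Subset d} (x∈Δ : x ∈Δ F) → ∀ k → x k ≡ proj₁ x∈Δ k
∈Δ-coordinate (λ' , _ , _ , _ , refl) k = begin
  ∑ (λ j → λ' j * e j k)  ≡⟨ ∑-supported (λ j → λ' j * e j k) k off-k ⟩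
  λ' k * e k k            ≡⟨ cong (λ' k *_) (e-diagonal k) ⟩
  λ' k * 1ℚ               ≡⟨ ℚ.*-identityʳ (λ' k) ⟩
  λ' k                    ∎
  where
  open ≡-Reasoning
  off-k : ∀ j → j ≢ k → λ' j * e j k ≡ 0ℚ
  off-k j j≢k = trans (cong (λ' j *_) (e-offDiagonal j≢k)) (ℚ.*-zeroʳ (λ' j))

module _ {x : Point d} {F : Subset d} (x∈Δ : x ∈Δ F) where

  ∈Δ-nonneg : ∀ k → 0ℚ ≤ x k
  ∈Δ-nonneg k = subst (0ℚ ≤_) (sym (∈Δ-coordinate x∈Δ k)) (proj₁ (proj₂ x∈Δ) k)

  ∈Δ-outside : ∀ k → k ∉ F → x k ≡ 0ℚ
  ∈Δ-outside k k∉F = trans (∈Δ-coordinate x∈Δ k) (proj₁ (proj₂ (proj₂ x∈Δ)) k k∉F)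

  ∈Δ-total : ∑ x ≡ 1ℚ
  ∈Δ-total = trans (∑-cong (∈Δ-coordinate x∈Δ)) (proj₁ (proj₂ (proj₂ (proj₂ x∈Δ))))

∈Δ-mono : {x : Point d} {F G : Subset d} → F ⊆ G → x ∈Δ F → x ∈Δ G
∈Δ-mono F⊆G (λ' , nonneg , outside , total , x≡) =
  λ' , nonneg , (λ k k∉G → outside k (k∉G ∘ F⊆G)) , total , x≡

∈Δ-∩ : {x : Point d} {F G : Subset d} → x ∈Δ F →
       (∀ {k} → k ∈ F → k ∉ G → x k ≡ 0ℚ) → x ∈Δ (F ∩ G)
∈Δ-∩ {F = F} {G} x∈Δ@(λ' , nonneg , outside , total , x≡) vanishes =
  λ' , nonneg , outside′ , total , x≡
  where
  outside′ : ∀ k → k ∉ F ∩ G → λ' k ≡ 0ℚ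
  outside′ k k∉F∩G with k ∈? F
  ... | no k∉F  = outside k k∉F
  ... | yes k∈F = trans (sym (∈Δ-coordinate x∈Δ k))
                        (vanishes k∈F (λ k∈G → k∉F∩G (x∈p∩q⁺ (k∈F , k∈G))))

keepIf : {P : Set ℓ} → Dec P → ℚ → ℚ
keepIf (yes _) v = v
keepIf (no _)  _ = 0ℚ

module _ {P : Set ℓ} where

  keepIf-≤ : (P? : Dec P) {v : ℚ} → 0ℚ ≤ v → keepIf P? v ≤ v
  keepIf-≤ (yes _) _   = ℚ.≤-refl
  keepIf-≤ (no _)  0≤v = 0≤v

  keepIf-nonneg : (P? : Dec P) {v : ℚ} → 0ℚ ≤ v → 0ℚ ≤ keepIf P? v
  keepIf-nonneg (yes _) 0≤v = 0≤v
  keepIf-nonneg (no _)  _   = ℚ.≤-refl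

  keepIf-no : (P? : Dec P) {v : ℚ} → ¬ P → keepIf P? v ≡ 0ℚ
  keepIf-no (yes p) ¬p = contradiction p ¬p
  keepIf-no (no _)  _  = refl

  keepIf-∑ : (P? : Dec P) (f : Fin m → ℚ) → keepIf P? (∑ f) ≡ ∑ (keepIf P? ∘ f)
  keepIf-∑     (yes _) f = refl
  keepIf-∑ {m} (no _) f = sym (∑-zero {m})

module _ {S : Pred (Fin d) ℓ} (S? : Decidable S) where

  mass : Point d → ℚ
  mass v = ∑ (λ k → keepIf (S? k) (v k))

  mass-∑ᵖ : (y : Fin n → Point d) → mass (∑ᵖ y) ≡ ∑ (mass ∘ y)
  mass-∑ᵖ y = trans (∑-cong (λ k → keepIf-∑ (S? k) (λ i → y i k)))
                    (sym (∑-comm (λ i k → keepIf (S? k) (y i k))))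

  mass-nonneg : {v : Point d} → (∀ k → 0ℚ ≤ v k) → 0ℚ ≤ mass v
  mass-nonneg 0≤v = ℚ.≤-trans (ℚ.≤-reflexive (sym (∑-zero {d})))
                              (∑-mono-≤ (λ k → keepIf-nonneg (S? k) (0≤v k)))

  module _ {v : Point d} {F : Subset d} (v∈Δ : v ∈Δ F) where

    mass-≤-1 : mass v ≤ 1ℚ
    mass-≤-1 = ℚ.≤-trans (∑-mono-≤ (λ k → keepIf-≤ (S? k) (∈Δ-nonneg v∈Δ k)))
                         (ℚ.≤-reflexive (∈Δ-total v∈Δ))

    mass-<-1 : ∀ {j} → ¬ S j → 0ℚ < v j → mass v < 1ℚ
    mass-<-1 {j} ¬Sj 0<vj = ℚ.<-≤-trans
      (∑-mono-< (λ k → keepIf-≤ (S? k) (∈Δ-nonneg v∈Δ k)) j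
                (subst (_< v j) (sym (keepIf-no (S? j) ¬Sj)) 0<vj))
      (ℚ.≤-reflexive (∈Δ-total v∈Δ))

    mass-≡-1 : (∀ {k} → k ∈ F → S k) → mass v ≡ 1ℚ
    mass-≡-1 F⊆S = trans (∑-cong kept) (∈Δ-total v∈Δ)
      where
      kept : ∀ k → keepIf (S? k) (v k) ≡ v k
      kept k with S? k
      ... | yes _  = refl
      ... | no ¬Sk = sym (∈Δ-outside v∈Δ k (¬Sk ∘ F⊆S))

    mass-≡-0 : (∀ {k} → k ∈ F → ¬ S k) → mass v ≡ 0ℚ
    mass-≡-0 F∩S≡∅ = trans (∑-cong dropped) (∑-zero {d})
      where
      dropped : ∀ k → keepIf (S? k) (v k) ≡ 0ℚ
      dropped k with S? k
      ... | yes Sk = ∈Δ-outside v∈Δ k (λ k∈F → F∩S≡∅ k∈F Sk)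
      ... | no _   = refl

ForwardClosed : Tuple n d → Tuple n d → Pred (Fin d) ℓ → Set ℓ
ForwardClosed A B S = ∀ {i u k} → u ∈ A i → S u → k ∈ B i → S k

module _ {A B : Tuple n d} {S : Pred (Fin d) ℓ} (S? : Decidable S) (closed : ForwardClosed A B S)
         {y z : Fin n → Point d} (y∈Δ : ∀ i → y i ∈Δ A i) (z∈Δ : ∀ i → z i ∈Δ B i) where

  mass-≤-forwardClosed : ∀ i → mass S? (y i) ≤ mass S? (z i)
  mass-≤-forwardClosed i with any? (λ u → (u ∈? A i) ×-dec S? u)
  ... | yes (u , u∈A , Su) = ℚ.≤-trans (mass-≤-1 S? (y∈Δ i))
                               (ℚ.≤-reflexive (sym (mass-≡-1 S? (z∈Δ i) (closed u∈A Su))))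
  ... | no ∄u = ℚ.≤-trans (ℚ.≤-reflexive (mass-≡-0 S? (y∈Δ i) (λ {k} k∈A Sk → ∄u (k , k∈A , Sk))))
                          (mass-nonneg S? (∈Δ-nonneg (z∈Δ i)))

  forwardClosed-no-escape : ∑ᵖ y ≡ ∑ᵖ z → ∀ {i j} → (∀ {k} → k ∈ B i → S k) → ¬ S j →
                            ¬ (0ℚ < y i j)
  forwardClosed-no-escape ∑y≡∑z {i} B⊆S ¬Sj 0<yij =
    ℚ.<-irrefl same-total (∑-mono-< mass-≤-forwardClosed i strict)
    where
    same-total : ∑ (mass S? ∘ y) ≡ ∑ (mass S? ∘ z)
    same-total = trans (sym (mass-∑ᵖ S? y)) (trans (cong (mass S?) ∑y≡∑z) (mass-∑ᵖ S? z))
    strict : mass S? (y i) < mass S? (z i)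
    strict = ℚ.<-≤-trans (mass-<-1 S? (y∈Δ i) ¬Sj 0<yij)
                         (ℚ.≤-reflexive (sym (mass-≡-1 S? (z∈Δ i) B⊆S)))

module _ {A B : Tuple n d} where

  infixr 5 _++ʷ_

  _++ʷ_ : ∀ {u v w} → Walk A B u v → Walk A B v w → Walk A B u w
  []             ++ʷ q = q
  fwd ed p       ++ʷ q = fwd ed (p ++ʷ q)
  bwd ed undir p ++ʷ q = bwd ed undir (p ++ʷ q)

  hasDirected-++ʷ : ∀ {u v w} {p : Walk A B u v} (q : Walk A B v w) →
                    HasDirected p → HasDirected (p ++ʷ q)
  hasDirected-++ʷ q (here ed p dir)            = here ed (p ++ʷ q) dir
  hasDirected-++ʷ q (there-fwd ed p has)       = there-fwd ed (p ++ʷ q) (hasDirected-++ʷ q has)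
  hasDirected-++ʷ q (there-bwd ed undir p has) = there-bwd ed undir (p ++ʷ q) (hasDirected-++ʷ q has)

DirectedlyReachable : Tuple n d → Tuple n d → Fin d → Pred (Fin d) _
DirectedlyReachable A B j k = Σ (Walk A B j k) HasDirected

module _ {A B : Tuple n d} {j : Fin d} where

  directedlyReachable-forwardClosed : ForwardClosed A B (DirectedlyReachable A B j)
  directedlyReachable-forwardClosed {i} {u} {k} u∈A (p , dir) k∈B with k ≟ u
  ... | yes refl = p , dir
  ... | no k≢u   = p ++ʷ fwd (edge i u k u∈A k∈B (k≢u ∘ sym)) [] , hasDirected-++ʷ _ dir

  directedlyReachable-⊇ : ∀ {i} → j ∈ A i → j ∉ B i → ∀ {k} → k ∈ B i → DirectedlyReachable A B j k
  directedlyReachable-⊇ {i} j∈A j∉B {k} k∈B = fwd ed [] , here ed [] directed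
    where
    ed : Edge A B
    ed = edge i j k j∈A k∈B (λ { refl → j∉B k∈B })
    directed : Directed ed
    directed (j∈A∩B , _) = j∉B (p∩q⊆q (A i) (B i) j∈A∩B)

¬¬-decidable : (P : Pred (Fin d) ℓ) → ¬ ¬ Decidable P
¬¬-decidable P = sequence rawApplicative (λ _ → ¬¬-excluded-middle)
  where open RawMonad ¬¬-Monad

acyclic⇒vanishes : {A B : Tuple n d} → Acyclic A B →
                   {y z : Fin n → Point d} → (∀ i → y i ∈Δ A i) → (∀ i → z i ∈Δ B i) →
                   ∑ᵖ y ≡ ∑ᵖ z → ∀ {i j} → j ∈ A i → j ∉ B i → y i j ≡ 0ℚ
acyclic⇒vanishes {A = A} {B} acyclic {y} y∈Δ z∈Δ ∑y≡∑z {i} {j} j∈A j∉B =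
  ℚ.≤-antisym (ℚ.≮⇒≥ not-positive) (∈Δ-nonneg (y∈Δ i) j)
  where
  not-positive : ¬ (0ℚ < y i j)
  not-positive 0<yij = ¬¬-decidable (DirectedlyReachable A B j) λ reachable? →
    forwardClosed-no-escape reachable? directedlyReachable-forwardClosed y∈Δ z∈Δ ∑y≡∑z
      (directedlyReachable-⊇ j∈A j∉B) (λ cycle → acyclic (j , cycle)) 0<yij

lemma3p5 : ∀ {n d} (A B : NDType n d) →
    Acyclic (proj₁ A) (proj₁ B) →
    ∀ (x : Point d) → ((x ∈C proj₁ A) × (x ∈C proj₁ B)) ⇔ (x ∈C (proj₁ A ∩ᵗ proj₁ B))
lemma3p5 (A , _) (B , _) acyclic x = mk⇔ to from
  where
  to : (x ∈C A) × (x ∈C B) → x ∈C (A ∩ᵗ B)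
  to ((y , y∈Δ , x≡∑y) , (z , z∈Δ , x≡∑z)) =
    y , (λ i → ∈Δ-∩ (y∈Δ i) (acyclic⇒vanishes acyclic y∈Δ z∈Δ (trans (sym x≡∑y) x≡∑z))) , x≡∑y

  from : x ∈C (A ∩ᵗ B) → (x ∈C A) × (x ∈C B)
  from (w , w∈Δ , x≡∑w) =
    (w , (λ i → ∈Δ-mono (p∩q⊆p (A i) (B i)) (w∈Δ i)) , x≡∑w) ,
    (w , (λ i → ∈Δ-mono (p∩q⊆q (A i) (B i)) (w∈Δ i)) , x≡∑w)
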